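{- Let $s,t$ be terms with $s\to_{\mathcal{R}}^{>\epsilon}t$ (a rewrite step below the root). For all $1\le i<d$: if $\mathrm{path}_i(s)=\mathrm{path}_i(t)$ and $\mathrm{nrm}_i(s)=\mathrm{nrm}_i(t)$, then either $\mathrm{path}_{i+1}(t)=\bot$ or $\mathrm{path}_{i+1}(s)=\mathrm{path}_{i+1}(t)$.
   Context: Setting. $\mathcal{R}$ is a finite TRS over a signature $\mathcal{F}$ with variables; defined symbols are roots of left-hand sides; $\to_{\mathcal{R}}$ rewrite relation; $\unlhd$ ($\lhd$) (proper) subterm, $\unrhd$, $\rhd$ the converses. For rule sets $\mathcal{P},\mathcal{S}$: $\to_{\mathcal{P}/\mathcal{S}}={\to^*_{\mathcal{S}}}\cdot{\to_{\mathcal{P}}}\cdot{\to^*_{\mathcal{S}}}$, $\mathrm{NF}(\mathcal{P}/\mathcal{S})$ its normal forms; $\mathrm{dh}(s,\to)=\max\{n\mid \exists u\, s\to^n u\}$. Dependency pairs: fresh $f^\sharp$ for defined $f$; $t^\sharp=f^\sharp(t_1,\dots,t_n)$ if $t=f(t_1,\dots,t_n)$, $t^\sharp=t$ for variables; $\mathrm{DP}(\mathcal{R})=\{l^\sharp\to u^\sharp\mid l\to r\in\mathcal{R},u\unlhd r,u\not\lhd l,\text{root of }u\text{ defined}\}$. A DP problem is $(\mathcal{P},\mathcal{R})$ with $\mathcal{P}\subseteq\mathrm{DP}(\mathcal{R})$. Processors: (RP) with reduction pair $(\succcurlyeq,\succ)$ ($\succcurlyeq$ preorder closed under contexts and substitutions,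 $\succ$ well-founded order closed under substitutions, ${\succcurlyeq}\cdot{\succ}\cdot{\succcurlyeq}\subseteq{\succ}$): $\Phi((\mathcal{P},\mathcal{R}))=\{(\mathcal{Q},\mathcal{R})\}$ where $\mathcal{Q}\cup\mathcal{R}\subseteq{\succcurlyeq}$, $\mathcal{P}\setminus\mathcal{Q}\subseteq{\succ}$. (DG) The dependency graph $G=\mathrm{DG}(\mathcal{P},\mathcal{R})$ has nodes $\mathcal{P}$, edge from $s\to t$ to $u\to v$ iff $t\sigma\to^*_{\mathcal{R}}u\tau$ for some $\sigma,\tau$; SCCs are maximal sets of mutually path-connected nodes; an SCC is trivial if it is one node whose only path to itself is empty. $\Phi((\mathcal{P},\mathcal{R}))$ is the set of $(\mathcal{Q},\mathcal{R})$ for nontrivial SCCs $\mathcal{Q}$. Ranks: with $k$ SCCs (trivial and nontrivial), $\mathrm{rk}(G,\cdot)$ is a fixed bijection from the SCCs onto $\{1,\dots,k\}$ with $\mathrm{rk}(G,\mathcal{P}_1)>\mathrm{rk}(G,\mathcal{P}_2)$ whenever some node of $\mathcal{P}_2$ is reachable by a path from some node of $\mathcal{P}_1$ ($\mathcal{P}_1\ne\mathcal{P}_2$); $\mathrm{rk}(G,l\to r)$ is the rank of the SCC containing $l\to r$; for a term $t$, $\mathrm{rk}(G,t)=\max\{\mathrm{rk}(G,l\to r)\mid l\to r\in\mathcal{P},\exists\sigma\ t^\sharp\to^*_{\mathcal{R}}l\sigma\}$. (SC) A simple projection $\pi$ picks an argument index $\pi(f^\sharp)$ for each $f^\sharp$,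 $\pi(f^\sharp(t_1,\dots,t_n))=t_{\pi(f^\sharp)}$; $\Phi((\mathcal{P},\mathcal{R}))=\{(\mathcal{Q},\mathcal{R})\}$ where $\pi(l)\unrhd\pi(r)$ for $l\to r\in\mathcal{Q}$ and $\pi(l)\rhd\pi(r)$ for $l\to r\in\mathcal{P}\setminus\mathcal{Q}$. Proof tree $\mathcal{T}$ (fixed): nodes are DP problems, root $(\mathrm{DP}(\mathcal{R}),\mathcal{R})$; each inner node $(\mathcal{P},\mathcal{R})$ has one of the three processors $\Phi$ with $\Phi((\mathcal{P},\mathcal{R}))\neq\{(\mathcal{P},\mathcal{R})\}$, and its children are exactly the elements of $\Phi((\mathcal{P},\mathcal{R}))$, plus, if $\Phi$ is (DG) with graph $G$, a leaf $(\mathcal{Q},\mathcal{R})$ for each trivial SCC $\mathcal{Q}$ of $G$; in the (DG) case children are ordered left to right by decreasing rank. Every leaf is $(\varnothing,\mathcal{R})$ or such a trivial-SCC leaf. Node positions are sequences of numbers ($\epsilon$ the root, $\alpha j$ the $j$-th child of $\alpha$). $d$ denotes the depth of $\mathcal{T}$ plus one. $\mathcal{R}$ is terminating. Current path: if $t^\sharp\in\mathrm{NF}(\mathrm{DP}(\mathcal{R})/\mathcal{R})$, $\mathrm{path}(t)=()$. Otherwise, for each $l\to r\in\mathrm{DP}(\mathcal{R})$ with $t^\sharp\notin\mathrm{NF}(\{l\to r\}/\mathcal{R})$, the set of nodes of $\mathcal{T}$ whose first component contains $l\to r$ forms a path from the root; $\mathrm{path}(t)=(\alpha_1=\epsilon,\dots,\alpha_n)$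 is the leftmost of these paths (w.r.t. the order of children). $\mathrm{path}_i(t)=\alpha_i$ if $i\le n$, and $\bot$ otherwise. Norm: for $i\in\mathbb{N}$ and $\alpha=\mathrm{path}_i(t)$: if $\alpha=\bot$, $\mathrm{nrm}_i(t)=0$ if the root of $t$ is defined and $\bot$ otherwise; if the node $(\mathcal{P},\mathcal{R})$ at $\alpha$ is a leaf, $\mathrm{nrm}_i(t)=\mathrm{dh}(t^\sharp,\to_{\mathcal{P}/\mathcal{R}})$; if it is an inner node with processor (RP) and child $(\mathcal{Q},\mathcal{R})$, $\mathrm{nrm}_i(t)=\mathrm{dh}(t^\sharp,\to_{(\mathcal{P}\setminus\mathcal{Q})/(\mathcal{Q}\cup\mathcal{R})})$; with (DG) and graph $G$, $\mathrm{nrm}_i(t)=\mathrm{rk}(G,t)$; with (SC) and projection $\pi$, $\mathrm{nrm}_i(t)=\pi(t^\sharp)$ (a term). -}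

module Defs where

open import Data.Nat using (ℕ; zero; suc; _≤_; _<_; _∸_)
open import Data.Fin using (Fin; toℕ)
open import Data.Vec using (Vec; []; _∷_; lookup; _[_]≔_)
open import Data.List using (List; []; _∷_; _++_; length)
open import Data.List.Membership.Propositional using (_∈_)
open import Data.Product using (Σ; ∃; ∃₂; _×_; _,_; proj₁)
open import Data.Sum using (_⊎_; inj₁; inj₂; [_,_]′)
open import Data.Maybe using (Maybe; just; nothing)
open import Data.Empty using (⊥)
open import Relation.Binary.PropositionalEquality using (_≡_; _≢_)
open import Relation.Nullary using (¬_)
open import Relation.Binary.Construct.Closure.ReflexiveTransitive using (Star)
open import Relation.Binary.Construct.Closure.Transitive using (TransClosure)
open import Induction.WellFounded using (WellFounded)
open import Function using (flip)

data Term {S : Set} (ar : S → ℕ) : Set where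
  var : ℕ → Term ar
  fun : (f : S) → Vec (Term ar) (ar f) → Term ar

module TermOps {S : Set} {ar : S → ℕ} where

  Tm : Set
  Tm = Term ar

  Subst : Set
  Subst = ℕ → Tm

  mutual
    subst : Subst → Tm → Tm
    subst σ (var x)    = σ x
    subst σ (fun f ts) = fun f (substs σ ts)

    substs : ∀ {n} → Subst → Vec Tm n → Vec Tm n
    substs σ []       = []
    substs σ (t ∷ ts) = subst σ t ∷ substs σ ts

  data _⊴_ : Tm → Tm → Set where
    ⊴-refl : ∀ {t} → t ⊴ t
    ⊴-arg  : ∀ {u f ts} (i : Fin (ar f)) → u ⊴ lookup ts i → u ⊴ fun f ts

  data _◁_ : Tm → Tm → Set where
    ◁-arg : ∀ {u f ts} (i : Fin (ar f)) → u ⊴ lookup ts i → u ◁ fun f ts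

  data _∈V_ (x : ℕ) : Tm → Set where
    here : x ∈V var x
    arg  : ∀ {f ts} (i : Fin (ar f)) → x ∈V lookup ts i → x ∈V fun f ts

  data Ctx : Set where
    □    : Ctx
    node : (f : S) → Vec Tm (ar f) → Fin (ar f) → Ctx → Ctx

  plug : Ctx → Tm → Tm
  plug □ t                = t
  plug (node f ts i C) t  = fun f (ts [ i ]≔ plug C t)

  Rule : Set
  Rule = Tm × Tm

  RuleSet : Set₁
  RuleSet = Rule → Set

  data Step (Rs : RuleSet) : Tm → Tm → Set where
    root : ∀ {l r} → Rs (l , r) → (σ : Subst) → Step Rs (subst σ l) (subst σ r)
    arg  : ∀ {f ts u} (i : Fin (ar f)) → Step Rs (lookup ts i) u →
           Step Rs (fun f ts) (fun f (ts [ i ]≔ u))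

  data StepBelow (Rs : RuleSet) : Tm → Tm → Set where
    below : ∀ {f ts u} (i : Fin (ar f)) → Step Rs (lookup ts i) u →
            StepBelow Rs (fun f ts) (fun f (ts [ i ]≔ u))

  RelStep : RuleSet → RuleSet → Tm → Tm → Set
  RelStep P Sr s t = Σ Tm λ s' → Σ Tm λ t' →
    Star (Step Sr) s s' × Step P s' t' × Star (Step Sr) t' t

  NF : RuleSet → RuleSet → Tm → Set
  NF P Sr t = ∀ u → ¬ RelStep P Sr t u

  data Iter (_⇒_ : Tm → Tm → Set) : ℕ → Tm → Tm → Set where
    done : ∀ {t} → Iter _⇒_ zero t t
    more : ∀ {n s s' t} → s ⇒ s' → Iter _⇒_ n s' t → Iter _⇒_ (suc n) s t

  Dh : (Tm → Tm → Set) → Tm → ℕ → Set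
  Dh _⇒_ s n = (∃ λ u → Iter _⇒_ n s u) × (∀ m u → Iter _⇒_ m s u → m ≤ n)

  record IsReductionPair (_≽_ _≻_ : Tm → Tm → Set) : Set where
    field
      ≽-refl  : ∀ t → t ≽ t
      ≽-trans : ∀ a b c → a ≽ b → b ≽ c → a ≽ c
      ≽-ctx   : ∀ (C : Ctx) s t → s ≽ t → plug C s ≽ plug C t
      ≽-subst : ∀ (σ : Subst) s t → s ≽ t → subst σ s ≽ subst σ t
      ≻-trans : ∀ a b c → a ≻ b → b ≻ c → a ≻ c
      ≻-wf    : WellFounded (flip _≻_)
      ≻-subst : ∀ (σ : Subst) s t → s ≻ t → subst σ s ≻ subst σ t
      compat  : ∀ a b c e → a ≽ b → b ≻ c → c ≽ e → a ≻ e

module Framework {F : Set} (ar : F → ℕ) (R : List (Term ar × Term ar)) where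

  open TermOps

  -- marked signature F ∪ F♯ : inj₁ f = f, inj₂ f = f♯
  ar♯ : F ⊎ F → ℕ
  ar♯ = [ ar , ar ]′

  Tm₀ : Set
  Tm₀ = Term ar

  Tm♯ : Set
  Tm♯ = Term ar♯

  Rule♯ : Set
  Rule♯ = Tm♯ × Tm♯

  mutual
    emb : Tm₀ → Tm♯
    emb (var x)    = var x
    emb (fun f ts) = fun (inj₁ f) (embs ts)

    embs : ∀ {n} → Vec Tm₀ n → Vec Tm♯ n
    embs []       = []
    embs (t ∷ ts) = emb t ∷ embs ts

  sharp : Tm₀ → Tm♯
  sharp (var x)    = var x
  sharp (fun f ts) = fun (inj₂ f) (embs ts)

  RR : Rule {S = F} {ar = ar} → Set
  RR ρ = ρ ∈ R

  R♯ : Rule♯ → Set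
  R♯ (l' , r') = Σ Tm₀ λ l → Σ Tm₀ λ r → (l , r) ∈ R × l' ≡ emb l × r' ≡ emb r

  Defined : F → Set
  Defined f = Σ (Vec Tm₀ (ar f)) λ ts → Σ Tm₀ λ r → (fun f ts , r) ∈ R

  DefinedRoot : Tm₀ → Set
  DefinedRoot (var _)   = ⊥
  DefinedRoot (fun f _) = Defined f

  -- standard TRS conditions, finiteness is built in (R is a list)
  WellFormedTRS : Set
  WellFormedTRS = ∀ l r → (l , r) ∈ R →
    (∀ x → l ≢ var x) × (∀ x → x ∈V r → x ∈V l)

  Terminating : Set
  Terminating = WellFounded (flip (Step RR))

  DP : Rule♯ → Set
  DP (l' , r') = Σ Tm₀ λ l → Σ Tm₀ λ r → Σ Tm₀ λ u →
    (l , r) ∈ R × u ⊴ r × ¬ (u ◁ l) × DefinedRoot u × l' ≡ sharp l × r' ≡ sharp u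

  -- DP problems (P, R): R is fixed, so a problem is its set P
  Prob : Set₁
  Prob = Rule♯ → Set

  _≐_ : Prob → Prob → Set
  P ≐ Q = ∀ ρ → (P ρ → Q ρ) × (Q ρ → P ρ)

  Edge : Rule♯ → Rule♯ → Set
  Edge (s , t) (u , v) = Σ Subst λ σ → Σ Subst λ τ →
    Star (Step R♯) (subst σ t) (subst τ u)

  EdgeIn : Prob → Rule♯ → Rule♯ → Set
  EdgeIn P x y = P x × P y × Edge x y

  Reach : Prob → Rule♯ → Rule♯ → Set
  Reach P = Star (EdgeIn P)

  IsSCC : Prob → Prob → Set
  IsSCC P Q = (∀ ρ → Q ρ → P ρ) × (∃ λ ρ → Q ρ)
    × (∀ x y → Q x → Q y → Reach P x y)
    × (∀ x y → Q x → P y → Reach P x y → Reach P y x → Q y)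

  TrivialSCC : Prob → Prob → Set
  TrivialSCC P Q = IsSCC P Q ×
    (∃ λ x → (Q ≐ (λ ρ → ρ ≡ x)) × ¬ TransClosure (EdgeIn P) x x)

  NontrivialSCC : Prob → Prob → Set
  NontrivialSCC P Q = IsSCC P Q × ¬ TrivialSCC P Q

  -- simple projections (partial: nullary f♯ has no argument to pick)
  Proj : Set
  Proj = (f : F) → Maybe (Fin (ar f))

  proj : Proj → Tm♯ → Maybe Tm♯
  proj π (var _)           = nothing
  proj π (fun (inj₁ f) ts) = nothing
  proj π (fun (inj₂ f) ts) with π f
  ... | just i  = just (lookup ts i)
  ... | nothing = nothing

  data Tree : Set₁ where
    leaf : Prob → Tree
    rpN  : Prob → (_≽_ _≻_ : Tm♯ → Tm♯ → Set) → Tree → Tree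
    dgN  : Prob → (k : ℕ) → (Fin k → Tree) → Tree
    scN  : Prob → Proj → Tree → Tree

  label : Tree → Prob
  label (leaf P)        = P
  label (rpN P _ _ _)   = P
  label (dgN P _ _)     = P
  label (scN P _ _)     = P

  data IsLeaf : Tree → Set₁ where
    isLeaf : ∀ {P} → IsLeaf (leaf P)

  -- validity of a (sub)tree; DG children are ordered by decreasing rank:
  -- the j-th child (j = 0 .. k-1) has rank k ∸ j.
  data Valid : Tree → Set₁ where
    vLeaf : ∀ {P} → (∀ ρ → ¬ P ρ) → Valid (leaf P)
    vRP   : ∀ {P _≽_ _≻_ c} → IsReductionPair {ar = ar♯} _≽_ _≻_ →
            (∀ ρ → label c ρ → P ρ) →
            (∀ l r → label c (l , r) → l ≽ r) →
            (∀ l r → R♯ (l , r) → l ≽ r) →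
            (∀ l r → P (l , r) → ¬ label c (l , r) → l ≻ r) →
            ¬ (label c ≐ P) →
            Valid c → Valid (rpN P _≽_ _≻_ c)
    vDG   : ∀ {P k} {ch : Fin k → Tree} →
            (∀ j → IsSCC P (label (ch j))) →
            (∀ Q → IsSCC P Q → ∃ λ j → Q ≐ label (ch j)) →
            (∀ j j' → label (ch j) ≐ label (ch j') → j ≡ j') →
            (∀ j j' x y → j ≢ j' → label (ch j) x → label (ch j') y →
                Reach P x y → toℕ j < toℕ j') →
            (∀ j → TrivialSCC P (label (ch j)) → IsLeaf (ch j)) →
            (∀ j → NontrivialSCC P (label (ch j)) → Valid (ch j)) →
            ¬ (∀ Q → (NontrivialSCC P Q → Q ≐ P) × (Q ≐ P → NontrivialSCC P Q)) →
            Valid (dgN P k ch)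
    vSC   : ∀ {P π c} →
            (∀ ρ → label c ρ → P ρ) →
            (∀ l r → label c (l , r) → Σ Tm♯ λ a → Σ Tm♯ λ b →
                proj π l ≡ just a × proj π r ≡ just b × b ⊴ a) →
            (∀ l r → P (l , r) → ¬ label c (l , r) → Σ Tm♯ λ a → Σ Tm♯ λ b →
                proj π l ≡ just a × proj π r ≡ just b × b ◁ a) →
            ¬ (label c ≐ P) →
            Valid c → Valid (scN P π c)

  ProofTree : Tree → Set₁
  ProofTree T = Valid T × (label T ≐ DP)

  -- node positions (children numbered from 1)
  Pos : Set
  Pos = List ℕ

  data SubtreeAt : Tree → Pos → Tree → Set₁ where
    here : ∀ {T} → SubtreeAt T [] T
    inRP : ∀ {P ge gt c α T'} → SubtreeAt c α T' → SubtreeAt (rpN P ge gt c) (1 ∷ α) T'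
    inSC : ∀ {P π c α T'} → SubtreeAt c α T' → SubtreeAt (scN P π c) (1 ∷ α) T'
    inDG : ∀ {P k ch α T'} (j : Fin k) → SubtreeAt (ch j) α T' →
           SubtreeAt (dgN P k ch) (suc (toℕ j) ∷ α) T'

  Depth : Tree → ℕ → Set₁
  Depth T n = (Σ Pos λ α → Σ Tree λ T' → SubtreeAt T α T' × length α ≡ n)
    × (∀ α T' → SubtreeAt T α T' → length α ≤ n)

  Contains : Tree → Pos → Rule♯ → Set₁
  Contains T α ρ = Σ Tree λ T' → SubtreeAt T α T' × label T' ρ

  data Chain : Pos → List Pos → Set where
    end  : ∀ {α} → Chain α (α ∷ [])
    step : ∀ {α as} (j : ℕ) → Chain (α ++ j ∷ []) as → Chain α (α ∷ as)

  RulePath : Tree → Rule♯ → List Pos → Set₁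
  RulePath T ρ as = Chain [] as ×
    (∀ β → (β ∈ as → Contains T β ρ) × (Contains T β ρ → β ∈ as))

  -- left-to-right order of positions; an extension counts as further left
  data _≼_ : Pos → Pos → Set where
    ≼-end : ∀ {α} → α ≼ []
    ≼-lt  : ∀ {i j α β} → i < j → (i ∷ α) ≼ (j ∷ β)
    ≼-eq  : ∀ {i α β} → α ≼ β → (i ∷ α) ≼ (i ∷ β)

  data _⊑_ : List Pos → List Pos → Set where
    ⊑-end : ∀ {as} → as ⊑ []
    ⊑-lt  : ∀ {α β as bs} → α ≼ β → α ≢ β → (α ∷ as) ⊑ (β ∷ bs)
    ⊑-eq  : ∀ {α as bs} → as ⊑ bs → (α ∷ as) ⊑ (α ∷ bs)

  Applicable : Tm₀ → Rule♯ → Set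
  Applicable t ρ = DP ρ × ¬ NF (λ ρ' → ρ' ≡ ρ) R♯ (sharp t)

  CurPath : Tree → Tm₀ → List Pos → Set₁
  CurPath T t ps =
      (NF DP R♯ (sharp t) × ps ≡ [])
    ⊎ (¬ NF DP R♯ (sharp t) × Σ Rule♯ λ ρ → Applicable t ρ × RulePath T ρ ps ×
         (∀ ρ' qs → Applicable t ρ' → RulePath T ρ' qs → ps ⊑ qs))

  -- path_i(t) = at (i ∸ 1) ps  (nothing = ⊥), for i ≥ 1
  at : ∀ {A : Set} → ℕ → List A → Maybe A
  at _       []       = nothing
  at zero    (x ∷ _)  = just x
  at (suc n) (_ ∷ xs) = at n xs

  data NVal : Set where
    num  : ℕ → NVal
    bot  : NVal
    term : Tm♯ → NVal

  IsMax : (ℕ → Set) → ℕ → Set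
  IsMax S n = S n × (∀ m → S m → m ≤ n)

  NodeNrm : Tree → Tm₀ → NVal → Set
  NodeNrm (leaf P) t v = Σ ℕ λ n → v ≡ num n × Dh (RelStep P R♯) (sharp t) n
  NodeNrm (rpN P _ _ c) t v = Σ ℕ λ n → v ≡ num n ×
    Dh (RelStep (λ ρ → P ρ × ¬ label c ρ) (λ ρ → label c ρ ⊎ R♯ ρ)) (sharp t) n
  NodeNrm (dgN P k ch) t v = Σ ℕ λ n → v ≡ num n × IsMax (λ m →
    Σ Rule♯ λ ρ → P ρ × (Σ Subst λ σ → Star (Step R♯) (sharp t) (subst σ (proj₁ ρ)))
      × Σ (Fin k) λ j → label (ch j) ρ × m ≡ k ∸ toℕ j) n
  NodeNrm (scN P π c) t v = Σ Tm♯ λ u → v ≡ term u × proj π (sharp t) ≡ just u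

  Nrm : Tree → List Pos → ℕ → Tm₀ → NVal → Set₁
  Nrm T ps i t v =
      (at (i ∸ 1) ps ≡ nothing × ((DefinedRoot t × v ≡ num 0) ⊎ (¬ DefinedRoot t × v ≡ bot)))
    ⊎ (Σ Pos λ α → at (i ∸ 1) ps ≡ just α × Σ Tree λ T' → SubtreeAt T α T' × NodeNrm T' t v)

module Submission where

-- A step s → t below the root is an R-step s♯ → t♯, so every dependency pair
-- applicable to t is applicable to s, and path(s) lies weakly left of path(t).
-- Once both paths pass through a common node α, path(s) therefore continues to a
-- child of α no further right than path(t) does.  (RP) and (SC) nodes have a
-- single child.  At a (DG) node the children are ordered by decreasing rank:
-- nrm(s) is at least the rank of the SCC on path(s), while nrm(t) is the rank of
-- an SCC containing a pair reachable from t♯, which by minimality of path(t) lies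
-- no further left than the SCC on path(t).  Equal norms make the children equal.

open import Defs
open import Data.Nat using (ℕ; zero; suc; _≤_; _<_; _∸_; s≤s; _≤?_)
open import Data.Nat.Properties using (≤-refl; ≤-trans; <⇒≤; ≤-pred; suc-injective; n≮n; ∸-monoʳ-≤; ∸-cancelʳ-≤)
import Data.Nat.Properties as ℕ
open import Data.Fin using (Fin; toℕ; zero; suc)
open import Data.Fin.Properties using (toℕ<n; toℕ-injective)
open import Data.Vec using (Vec; []; _∷_; lookup; _[_]≔_)
open import Data.List using (List; []; _∷_; _++_; length; map; take)
open import Data.List.Properties using (∷-injective; ∷-injectiveˡ; ∷-injectiveʳ; ++-cancelˡ; ++-assoc; ++-identityʳ; length-++)
open import Data.List.Membership.Propositional using (_∈_)
open import Data.List.Membership.Propositional.Properties using (∈-map⁺; ∈-map⁻)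
open import Data.List.Membership.DecPropositional (Data.List.Properties.≡-dec ℕ._≟_) using (_∈?_)
open import Data.List.Relation.Unary.Any using (here; there)
open import Data.Product using (Σ; ∃; _×_; _,_; proj₁; proj₂)
open import Data.Sum using (_⊎_; inj₁; inj₂)
open import Data.Maybe using (just; nothing)
open import Data.Maybe.Properties using (just-injective)
open import Relation.Nullary using (¬_)
open import Relation.Nullary.Negation using (¬¬-map; negated-stable; contradiction)
open import Relation.Nullary.Decidable using (decidable-stable; ¬¬-excluded-middle; yes; no)
open import Relation.Binary.PropositionalEquality using (_≡_; _≢_; refl; sym; trans; cong; cong₂; subst₂)
import Relation.Binary.PropositionalEquality as ≡
open import Relation.Binary.Construct.Closure.ReflexiveTransitive using (Star; ε; _◅_)

-- The double-negation monad, at mixed universe levels (stdlib's ¬¬-Monad is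
-- single-level).  Normal forms are defined negatively and the SCC bookkeeping
-- needs excluded middle; every goal it is run for is decidable.
private
  pure : ∀ {a} {A : Set a} → A → ¬ ¬ A
  pure x ¬x = ¬x x

  _>>=_ : ∀ {a b} {A : Set a} {B : Set b} → ¬ ¬ A → (A → ¬ ¬ B) → ¬ ¬ B
  m >>= f = negated-stable (¬¬-map f m)

prefix-unique : ∀ {A : Set} (xs ys ds es : List A) → xs ++ ds ≡ ys ++ es → length xs ≡ length ys → xs ≡ ys
prefix-unique []       []       _  _  _ _ = refl
prefix-unique (x ∷ xs) (y ∷ ys) ds es e l with ∷-injective e
... | refl , e′ = cong (x ∷_) (prefix-unique xs ys ds es e′ (suc-injective l))

snoc-injective : ∀ {A : Set} (xs : List A) {a b} → xs ++ a ∷ [] ≡ xs ++ b ∷ [] → a ≡ b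
snoc-injective xs e = ∷-injectiveˡ (++-cancelˡ xs _ _ e)

lookup-[]≔-∀ : ∀ {A : Set} {P : A → Set} {n} (ts : Vec A n) i {w} →
             (∀ j → P (lookup ts j)) → P w → ∀ j → P (lookup (ts [ i ]≔ w) j)
lookup-[]≔-∀ (_ ∷ _)  zero    all pw zero    = pw
lookup-[]≔-∀ (_ ∷ _)  zero    all pw (suc j) = all (suc j)
lookup-[]≔-∀ (_ ∷ _)  (suc i) all pw zero    = all zero
lookup-[]≔-∀ {P = P} (_ ∷ ts) (suc i) all pw (suc j) = lookup-[]≔-∀ {P = P} ts i (λ j → all (suc j)) pw j

module _ {F : Set} (ar : F → ℕ) (R : List (Term ar × Term ar)) where
  open TermOps
  open Framework ar R

  at⇒∈ : ∀ {A : Set} n {xs : List A} {x} → at n xs ≡ just x → x ∈ xs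
  at⇒∈ zero    {_ ∷ _}  refl = here refl
  at⇒∈ (suc n) {_ ∷ xs} e    = there (at⇒∈ n e)

  ∈⇒at : ∀ {A : Set} {xs : List A} {x} → x ∈ xs → ∃ λ n → at n xs ≡ just x
  ∈⇒at (here refl) = zero , refl
  ∈⇒at (there x∈xs) with ∈⇒at x∈xs
  ... | n , e = suc n , e

  at-suc⇒at : ∀ {A : Set} n (xs : List A) {y} → at (suc n) xs ≡ just y → ∃ λ x → at n xs ≡ just x
  at-suc⇒at zero    (x ∷ _)  _ = x , refl
  at-suc⇒at (suc n) (_ ∷ xs) e = at-suc⇒at n xs e

  chain-head : ∀ {β as} → Chain β as → at 0 as ≡ just β
  chain-head end        = refl
  chain-head (step _ _) = refl

  chain-at : ∀ {β as} n {α} → Chain β as → at n as ≡ just α → ∃ λ δ → α ≡ β ++ δ × length δ ≡ n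
  chain-at zero    c            e    with trans (sym (chain-head c)) e
  ... | refl = [] , sym (++-identityʳ _) , refl
  chain-at {β} (suc n) (step j c) e with chain-at n c e
  ... | δ , refl , l = j ∷ δ , ++-assoc β (j ∷ []) δ , cong suc l

  chain-at-suc : ∀ {β as} n {α γ} → Chain β as → at n as ≡ just α → at (suc n) as ≡ just γ →
                 ∃ λ j → γ ≡ α ++ j ∷ []
  chain-at-suc zero    (step j c) refl e′ with trans (sym (chain-head c)) e′
  ... | refl = j , refl
  chain-at-suc (suc n) (step _ c) e e′ = chain-at-suc n c e e′

  chain-take : ∀ {β as bs} n {α} → Chain β as → Chain β bs → at n as ≡ just α → at n bs ≡ just α →
               take (suc n) as ≡ take (suc n) bs
  chain-take {as = _ ∷ _} {bs = _ ∷ _} zero _ _ refl refl = refl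
  chain-take {β} (suc n) (step j c) (step j′ c′) e e′ with chain-at n c e | chain-at n c′ e′
  ... | δ , α≡ , l | δ′ , α≡′ , l′
    with snoc-injective β (prefix-unique _ _ δ δ′ (trans (sym α≡) α≡′)
           (trans (length-++ β) (sym (length-++ β))))
  ... | refl = cong (β ∷_) (chain-take n c c′ e e′)

  root-chain-∈ : ∀ {as γ} → Chain [] as → γ ∈ as → at (length γ) as ≡ just γ
  root-chain-∈ {as} c γ∈as with ∈⇒at γ∈as
  ... | n , e with chain-at n c e
  ... | δ , refl , refl = e

  root-chain-length : ∀ {as} n {α} → Chain [] as → at n as ≡ just α → length α ≡ n
  root-chain-length n c e with chain-at n c e
  ... | _ , refl , l = l

  ≼-refl : ∀ {α} → α ≼ α
  ≼-refl {[]}    = ≼-end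
  ≼-refl {_ ∷ _} = ≼-eq ≼-refl

  ≼-snoc⇒≤ : ∀ (α : Pos) {a b} → (α ++ a ∷ []) ≼ (α ++ b ∷ []) → a ≤ b
  ≼-snoc⇒≤ []      (≼-lt a<b)  = <⇒≤ a<b
  ≼-snoc⇒≤ []      (≼-eq _)    = ≤-refl
  ≼-snoc⇒≤ (_ ∷ α) (≼-lt i<i)  = contradiction i<i (n≮n _)
  ≼-snoc⇒≤ (_ ∷ α) (≼-eq α≼β)  = ≼-snoc⇒≤ α α≼β

  ⊑-next : ∀ {as bs} n {β} → as ⊑ bs → take (suc n) as ≡ take (suc n) bs → at (suc n) bs ≡ just β →
           ∃ λ α → at (suc n) as ≡ just α × α ≼ β
  ⊑-next n (⊑-lt _ x≢y) e _ = contradiction (∷-injectiveˡ e) x≢y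
  ⊑-next {bs = _ ∷ _ ∷ _} zero (⊑-eq (⊑-lt α≼β _)) _ refl = _ , refl , α≼β
  ⊑-next {bs = _ ∷ _ ∷ _} zero (⊑-eq (⊑-eq _))     _ refl = _ , refl , ≼-refl
  ⊑-next {bs = _ ∷ _} (suc n) (⊑-eq r) e e′ = ⊑-next n r (∷-injectiveʳ e) e′

  ⊑-chain-next : ∀ {β as bs} n {α c} → Chain β as → Chain β bs → as ⊑ bs →
                 at n as ≡ just α → at n bs ≡ just α → at (suc n) bs ≡ just (α ++ c ∷ []) →
                 ∃ λ a → at (suc n) as ≡ just (α ++ a ∷ []) × a ≤ c
  ⊑-chain-next n {α} ca cb r e e′ e″ with ⊑-next n r (chain-take n ca cb e e′) e″
  ... | γ , eγ , γ≼ with chain-at-suc n ca e eγ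
  ... | a , refl = a , eγ , ≼-snoc⇒≤ α γ≼

  SubtreeAt-functional : ∀ {T α β U V} → SubtreeAt T α U → SubtreeAt T β V → α ≡ β → U ≡ V
  SubtreeAt-functional here       here         _ = refl
  SubtreeAt-functional (inRP s)   (inRP s′)    e = SubtreeAt-functional s s′ (∷-injectiveʳ e)
  SubtreeAt-functional (inSC s)   (inSC s′)    e = SubtreeAt-functional s s′ (∷-injectiveʳ e)
  SubtreeAt-functional (inDG j s) (inDG j′ s′) e with toℕ-injective (suc-injective (∷-injectiveˡ e))
  ... | refl = SubtreeAt-functional s s′ (∷-injectiveʳ e)

  SubtreeAt-++⁺ : ∀ {T α U γ V} → SubtreeAt T α U → SubtreeAt U γ V → SubtreeAt T (α ++ γ) V
  SubtreeAt-++⁺ here       s = s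
  SubtreeAt-++⁺ (inRP a)   s = inRP (SubtreeAt-++⁺ a s)
  SubtreeAt-++⁺ (inSC a)   s = inSC (SubtreeAt-++⁺ a s)
  SubtreeAt-++⁺ (inDG j a) s = inDG j (SubtreeAt-++⁺ a s)

  SubtreeAt-++⁻ : ∀ {T} α {γ V} → SubtreeAt T (α ++ γ) V → ∃ λ U → SubtreeAt T α U × SubtreeAt U γ V
  SubtreeAt-++⁻ []      s          = _ , here , s
  SubtreeAt-++⁻ (_ ∷ α) (inRP s)   with SubtreeAt-++⁻ α s
  ... | U , a , b = U , inRP a , b
  SubtreeAt-++⁻ (_ ∷ α) (inSC s)   with SubtreeAt-++⁻ α s
  ... | U , a , b = U , inSC a , b
  SubtreeAt-++⁻ (_ ∷ α) (inDG j s) with SubtreeAt-++⁻ α s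
  ... | U , a , b = U , inDG j a , b

  SubtreeAt-child : ∀ {T α U a V} → SubtreeAt T α U → SubtreeAt T (α ++ a ∷ []) V → SubtreeAt U (a ∷ []) V
  SubtreeAt-child {α = α} sU sV with SubtreeAt-++⁻ α sV
  ... | U′ , sU′ , sUV with SubtreeAt-functional sU sU′ refl
  ... | refl = sUV

  -- Children of a DG node for trivial SCCs are leaves, not valid subtrees.
  ValidOrLeaf : Tree → Set₁
  ValidOrLeaf U = Valid U ⊎ IsLeaf U

  dg-child : ∀ {P k ch} → Valid (dgN P k ch) → (j : Fin k) → ¬ ¬ ValidOrLeaf (ch j)
  dg-child (vDG scc _ _ _ trivial nontrivial _) j = do
    yes t ← ¬¬-excluded-middle
      where no nt → pure (inj₁ (nontrivial j (scc j , nt)))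
    pure (inj₂ (trivial j t))

  label-⊆-subtree : ∀ {U γ V ρ} → ValidOrLeaf U → SubtreeAt U γ V → label V ρ → ¬ ¬ label U ρ
  label-⊆-subtree _ here l = pure l
  label-⊆-subtree (inj₁ (vRP _ c⊆P _ _ _ _ vc)) (inRP s) l = do
    l′ ← label-⊆-subtree (inj₁ vc) s l
    pure (c⊆P _ l′)
  label-⊆-subtree (inj₁ (vSC c⊆P _ _ _ vc)) (inSC s) l = do
    l′ ← label-⊆-subtree (inj₁ vc) s l
    pure (c⊆P _ l′)
  label-⊆-subtree (inj₁ v@(vDG scc _ _ _ _ _ _)) (inDG j s) l = do
    vj ← dg-child v j
    l′ ← label-⊆-subtree vj s l
    pure (proj₁ (scc j) _ l′)

  SCC-≐ : ∀ {P Q₁ Q₂ x} → IsSCC P Q₁ → IsSCC P Q₂ → Q₁ x → Q₂ x → Q₁ ≐ Q₂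
  SCC-≐ (⊆₁ , _ , reach₁ , max₁) (⊆₂ , _ , reach₂ , max₂) x₁ x₂ ρ =
    (λ y → max₂ _ ρ x₂ (⊆₁ ρ y) (reach₁ _ _ x₁ y) (reach₁ _ _ y x₁)) ,
    (λ y → max₁ _ ρ x₁ (⊆₂ ρ y) (reach₂ _ _ x₂ y) (reach₂ _ _ y x₂))

  chain-map : ∀ {β as} x → Chain β as → Chain (x ∷ β) (map (x ∷_) as)
  chain-map x end        = end
  chain-map x (step j c) = step j (chain-map x c)

  rulePath-here : ∀ {U ρ} → label U ρ → (∀ {x γ V} → SubtreeAt U (x ∷ γ) V → ¬ label V ρ) →
                  RulePath U ρ ([] ∷ [])
  rulePath-here l nowhere = end , λ where
    []      → (λ _ → _ , here , l) , λ _ → here refl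
    (_ ∷ _) → (λ { (here ()) ; (there ()) }) , λ { (_ , s , l′) → contradiction l′ (nowhere s) }

  rulePath-child : ∀ {U c ρ as} x → label U ρ → SubtreeAt U (x ∷ []) c → RulePath c ρ as →
    (∀ {y γ V} → SubtreeAt U (y ∷ γ) V → label V ρ → ¬ ¬ (y ≡ x × Contains c γ ρ)) →
    RulePath U ρ ([] ∷ map (x ∷_) as)
  rulePath-child {U} {_} {ρ} {as} x l sc (ch , iff) inChild = step x (chain-map x ch) , λ where
      []      → (λ _ → _ , here , l) , λ _ → here refl
      (y ∷ γ) → into , out
    where
    into : ∀ {y γ} → y ∷ γ ∈ [] ∷ map (x ∷_) as → Contains U (y ∷ γ) ρ
    into (there m) with ∈-map⁻ (x ∷_) m
    ... | γ , m′ , refl with proj₁ (iff γ) m′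
    ... | V , s , l′ = V , SubtreeAt-++⁺ sc s , l′

    out : ∀ {y γ} → Contains U (y ∷ γ) ρ → y ∷ γ ∈ [] ∷ map (x ∷_) as
    out {γ = γ} (_ , s , l′) = decidable-stable (_ ∈? _) do
      refl , cγ ← inChild s l′
      pure (there (∈-map⁺ (x ∷_) (proj₂ (iff γ) cγ)))

  rulePath-unary : ∀ {U c ρ} → label U ρ → SubtreeAt U (1 ∷ []) c → Valid c →
    (∀ {y γ V} → SubtreeAt U (y ∷ γ) V → y ≡ 1 × SubtreeAt c γ V) →
    (label c ρ → ¬ ¬ ∃ (RulePath c ρ)) → ¬ ¬ ∃ (RulePath U ρ)
  rulePath-unary l sc vc inside rec = do
    yes lc ← ¬¬-excluded-middle
      where no ¬lc → pure (_ , rulePath-here l λ s l′ →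
                             label-⊆-subtree (inj₁ vc) (proj₂ (inside s)) l′ ¬lc)
    _ , p ← rec lc
    pure (_ , rulePath-child 1 l sc p λ s l′ → pure (proj₁ (inside s) , _ , proj₂ (inside s) , l′))

  rulePath-exists : ∀ U {ρ} → ValidOrLeaf U → label U ρ → ¬ ¬ ∃ (RulePath U ρ)
  rulePath-exists (leaf P) _ l = pure (_ , rulePath-here l λ ())
  rulePath-exists (rpN P _ _ c) (inj₁ (vRP _ _ _ _ _ _ vc)) l =
    rulePath-unary l (inRP here) vc (λ { (inRP s) → refl , s }) (rulePath-exists c (inj₁ vc))
  rulePath-exists (scN P _ c) (inj₁ (vSC _ _ _ _ vc)) l =
    rulePath-unary l (inSC here) vc (λ { (inSC s) → refl , s }) (rulePath-exists c (inj₁ vc))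
  rulePath-exists (dgN P k ch) {ρ} (inj₁ v@(vDG scc _ distinct _ _ _ _)) l = do
    yes (j , lj) ← ¬¬-excluded-middle {A = ∃ λ j → label (ch j) ρ}
      where no none → pure (_ , rulePath-here l λ { (inDG j s) l′ →
                               dg-child v j λ vj → label-⊆-subtree vj s l′ λ lj → none (j , lj) })
    vj ← dg-child v j
    _ , p ← rulePath-exists (ch j) vj lj
    pure (_ , rulePath-child (suc (toℕ j)) l (inDG j here) p λ { (inDG j′ s) l′ → do
      vj′ ← dg-child v j′
      lj′ ← label-⊆-subtree vj′ s l′
      refl ← pure (distinct j j′ (SCC-≐ (scc j) (scc j′) lj lj′))
      pure (refl , _ , s , l′) })

  rulePath-contains : ∀ {T ρ qs} n {α} → RulePath T ρ qs → at n qs ≡ just α → Contains T α ρ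
  rulePath-contains n (_ , iff) e = proj₁ (iff _) (at⇒∈ n e)

  rulePath-at : ∀ {T ρ qs n α} → RulePath T ρ qs → Contains T α ρ → length α ≡ n → at n qs ≡ just α
  rulePath-at (c , iff) cα refl = root-chain-∈ c (proj₂ (iff _) cα)

  lookup-embs : ∀ {n} (ts : Vec Tm₀ n) i → lookup (embs ts) i ≡ emb (lookup ts i)
  lookup-embs (_ ∷ _)  zero    = refl
  lookup-embs (_ ∷ ts) (suc i) = lookup-embs ts i

  embs-[]≔ : ∀ {n} (ts : Vec Tm₀ n) i u → embs (ts [ i ]≔ u) ≡ embs ts [ i ]≔ emb u
  embs-[]≔ (_ ∷ _)  zero    u = refl
  embs-[]≔ (t ∷ ts) (suc i) u = cong (emb t ∷_) (embs-[]≔ ts i u)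

  mutual
    emb-subst : ∀ (σ : Subst) t → emb (subst σ t) ≡ subst (λ x → emb (σ x)) (emb t)
    emb-subst σ (var x)    = refl
    emb-subst σ (fun f ts) = cong (fun (inj₁ f)) (embs-substs σ ts)

    embs-substs : ∀ (σ : Subst) {n} (ts : Vec Tm₀ n) → embs (substs σ ts) ≡ substs (λ x → emb (σ x)) (embs ts)
    embs-substs σ []       = refl
    embs-substs σ (t ∷ ts) = cong₂ _∷_ (emb-subst σ t) (embs-substs σ ts)

  Step-arg-embs : ∀ g (ts : Vec Tm₀ (ar♯ g)) i {u} → Step R♯ (emb (lookup ts i)) (emb u) →
                  Step R♯ (fun g (embs ts)) (fun g (embs (ts [ i ]≔ u)))
  Step-arg-embs g ts i {u} st rewrite embs-[]≔ ts i u =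
    arg i (≡.subst (λ w → Step R♯ w (emb u)) (sym (lookup-embs ts i)) st)

  emb-Step : ∀ {a b} → Step RR a b → Step R♯ (emb a) (emb b)
  emb-Step (root {l} {r} l→r σ) =
    subst₂ (Step R♯) (sym (emb-subst σ l)) (sym (emb-subst σ r)) (root (l , r , l→r , refl , refl) _)
  emb-Step (arg {f} {ts} i st) = Step-arg-embs (inj₁ f) ts i (emb-Step st)

  sharp-StepBelow : ∀ {s t} → StepBelow RR s t → Step R♯ (sharp s) (sharp t)
  sharp-StepBelow (below {f} {ts} i st) = Step-arg-embs (inj₂ f) ts i (emb-Step st)

  ¬NF-Step⁻ : ∀ {P a b} → Step R♯ a b → ¬ NF P R♯ b → ¬ NF P R♯ a
  ¬NF-Step⁻ st ¬nfb nfa = ¬nfb λ u (s′ , t′ , st₁ , sp , st₂) → nfa u (s′ , t′ , st ◅ st₁ , sp , st₂)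

  Step-mono : ∀ {P Q : Rule♯ → Set} {a b} → (∀ ρ → P ρ → Q ρ) → Step P a b → Step Q a b
  Step-mono P⊆Q (root p σ)  = root (P⊆Q _ p) σ
  Step-mono P⊆Q (arg i st) = arg i (Step-mono P⊆Q st)

  NF-DP⇒NF : ∀ {u ρ} → NF DP R♯ u → DP ρ → NF (_≡ ρ) R♯ u
  NF-DP⇒NF nf dp u (s′ , t′ , st₁ , sp , st₂) = nf u (s′ , t′ , st₁ , Step-mono (λ { _ refl → dp }) sp , st₂)

  StepBelow-applicable : ∀ {s t ρ} → StepBelow RR s t → Applicable t ρ → Applicable s ρ
  StepBelow-applicable st (dp , ¬nf) = dp , ¬NF-Step⁻ (sharp-StepBelow st) ¬nf

  Reaches : Tm₀ → Rule♯ → Set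
  Reaches t ρ = Σ Subst λ σ → Star (Step R♯) (sharp t) (subst σ (proj₁ ρ))

  reaches⇒¬NF : ∀ {t ρ} → Reaches t ρ → ¬ NF (_≡ ρ) R♯ (sharp t)
  reaches⇒¬NF (σ , st) nf = nf _ (_ , _ , st , root refl σ , ε)

  data Unmarked : Tm♯ → Set where
    var : ∀ {x} → Unmarked (var x)
    fun : ∀ {f ts} → (∀ i → Unmarked (lookup ts i)) → Unmarked (fun (inj₁ f) ts)

  mutual
    emb-unmarked : ∀ t → Unmarked (emb t)
    emb-unmarked (var x)    = var
    emb-unmarked (fun f ts) = fun (embs-unmarked ts)

    embs-unmarked : ∀ {n} (ts : Vec Tm₀ n) i → Unmarked (lookup (embs ts) i)
    embs-unmarked (t ∷ _)  zero    = emb-unmarked t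
    embs-unmarked (_ ∷ ts) (suc i) = embs-unmarked ts i

  lookup-substs-embs : ∀ (σ : Subst) {n} (ts : Vec Tm₀ n) i →
                       lookup (substs σ (embs ts)) i ≡ subst σ (emb (lookup ts i))
  lookup-substs-embs σ (_ ∷ _)  zero    = refl
  lookup-substs-embs σ (_ ∷ ts) (suc i) = lookup-substs-embs σ ts i

  unmarked-subst⁻ : ∀ (σ : Subst) {x} l → Unmarked (subst σ (emb l)) → x ∈V l → Unmarked (σ x)
  unmarked-subst⁻ σ (var x)    u       here      = u
  unmarked-subst⁻ σ (fun f ts) (fun u) (arg i m) =
    unmarked-subst⁻ σ (lookup ts i) (≡.subst Unmarked (lookup-substs-embs σ ts i) (u i)) m

  mutual
    unmarked-subst⁺ : ∀ (σ : Subst) r → (∀ x → x ∈V r → Unmarked (σ x)) → Unmarked (subst σ (emb r))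
    unmarked-subst⁺ σ (var x)    u = u x here
    unmarked-subst⁺ σ (fun f ts) u = fun (unmarked-substs⁺ σ ts λ i x m → u x (arg i m))

    unmarked-substs⁺ : ∀ (σ : Subst) {n} (ts : Vec Tm₀ n) → (∀ i x → x ∈V lookup ts i → Unmarked (σ x)) →
                       ∀ i → Unmarked (lookup (substs σ (embs ts)) i)
    unmarked-substs⁺ σ (t ∷ _)  u zero    = unmarked-subst⁺ σ t (u zero)
    unmarked-substs⁺ σ (_ ∷ ts) u (suc i) = unmarked-substs⁺ σ ts (λ i → u (suc i)) i

  IsSharp : F → Tm♯ → Set
  IsSharp f u = Σ (Vec Tm♯ (ar f)) λ us → u ≡ fun (inj₂ f) us × (∀ i → Unmarked (lookup us i))

  module _ (wf : WellFormedTRS) where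

    Step-unmarked : ∀ {u w} → Step R♯ u w → Unmarked u → Unmarked w
    Step-unmarked (root (l , r , l→r , refl , refl) σ) u =
      unmarked-subst⁺ σ r λ x m → unmarked-subst⁻ σ l u (proj₂ (wf l r l→r) x m)
    Step-unmarked (arg {ts = ts} i st) (fun u) = fun (lookup-[]≔-∀ {P = Unmarked} ts i u (Step-unmarked st (u i)))

    sharp-lhs-marked : ∀ (σ : Subst) l r → (l , r) ∈ R → ¬ Unmarked (subst σ (sharp l))
    sharp-lhs-marked σ (var x)   r l→r _ = proj₁ (wf (var x) r l→r) x refl
    sharp-lhs-marked σ (fun _ _) r l→r ()

    DP-Step-marked : ∀ {ρ u w} → DP ρ → Step (_≡ ρ) u w → ¬ Unmarked u
    DP-Step-marked (l , r , _ , l→r , _ , _ , _ , refl , _) (root refl σ) = sharp-lhs-marked σ l r l→r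
    DP-Step-marked dp (arg i st) (fun u) = DP-Step-marked dp st (u i)

    emb-lhs-≢-marked : ∀ (σ : Subst) l r → (l , r) ∈ R → ∀ {f us} → subst σ (emb l) ≢ fun (inj₂ f) us
    emb-lhs-≢-marked σ (var x)   r l→r _  = proj₁ (wf (var x) r l→r) x refl
    emb-lhs-≢-marked σ (fun _ _) r l→r ()

    IsSharp-Step : ∀ {f u w} → Step R♯ u w → IsSharp f u → IsSharp f w
    IsSharp-Step (root (l , r , l→r , refl , refl) σ) (_ , e , _) = contradiction e (emb-lhs-≢-marked σ l r l→r)
    IsSharp-Step (arg {ts = us} i st) (_ , refl , u) = _ , refl , lookup-[]≔-∀ {P = Unmarked} us i u (Step-unmarked st (u i))

    IsSharp-Star : ∀ {f u w} → Star (Step R♯) u w → IsSharp f u → IsSharp f w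
    IsSharp-Star ε          h = h
    IsSharp-Star (st ◅ sts) h = IsSharp-Star sts (IsSharp-Step st h)

    DP-Step-at-root : ∀ {f ρ u w} → DP ρ → Step (_≡ ρ) u w → IsSharp f u → ∃ λ σ → u ≡ subst σ (proj₁ ρ)
    DP-Step-at-root dp (root refl σ) _              = σ , refl
    DP-Step-at-root dp (arg i st)   (_ , refl , u) = contradiction (u i) (DP-Step-marked dp st)

    -- Every DP step from an R-reduct of t♯ is at the root: its arguments stay unmarked.
    applicable⇒reaches : ∀ {f ts ρ} → Applicable (fun f ts) ρ → ¬ ¬ Reaches (fun f ts) ρ
    applicable⇒reaches {f} {ts} (dp , ¬nf) ¬reach = ¬nf λ _ (_ , _ , sts , st , _) →
      let σ , e = DP-Step-at-root dp st (IsSharp-Star sts (_ , refl , embs-unmarked ts))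
      in ¬reach (σ , ≡.subst (Star (Step R♯) (sharp (fun f ts))) e sts)

  nrm-at : ∀ {T ps n t v α U} → Nrm T ps (suc n) t v → at n ps ≡ just α → SubtreeAt T α U → NodeNrm U t v
  nrm-at (inj₁ (e , _)) eα _ = contradiction (trans (sym e) eα) λ ()
  nrm-at (inj₂ (_ , e , _ , sU′ , nn)) eα sU with just-injective (trans (sym e) eα)
  ... | refl with SubtreeAt-functional sU sU′ refl
  ... | refl = nn

  child-index-≡ : ∀ U {s t ρs a b Vs Vt v} → label U ρs → SubtreeAt U (a ∷ []) Vs → label Vs ρs →
    SubtreeAt U (b ∷ []) Vt → a ≤ b → ¬ ¬ Reaches s ρs →
    (∀ {c ρ V} → label U ρ → SubtreeAt U (c ∷ []) V → label V ρ → Reaches t ρ → b ≤ c) →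
    NodeNrm U s v → NodeNrm U t v → a ≡ b
  child-index-≡ (rpN _ _ _ _) _ (inRP here) _ (inRP here) _ _ _ _ _ = refl
  child-index-≡ (scN _ _ _)   _ (inSC here) _ (inSC here) _ _ _ _ _ = refl
  child-index-≡ (dgN P k ch) lUs (inDG js here) lVs (inDG jt here) (s≤s js≤jt) reachS leftmostT
      (_ , refl , _ , rank-s-max) (_ , refl , (_ , lU , reachT , j , lV , refl) , _) =
    cong suc (ℕ.≤-antisym js≤jt jt≤js)
    where
    rank-js≤rank-j : k ∸ toℕ js ≤ k ∸ toℕ j
    rank-js≤rank-j = decidable-stable (_ ≤? _) do
      r ← reachS
      pure (rank-s-max _ (_ , lUs , r , js , lVs , refl))

    jt≤j : toℕ jt ≤ toℕ j
    jt≤j = ≤-pred (leftmostT lU (inDG j here) lV reachT)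

    jt≤js : toℕ jt ≤ toℕ js
    jt≤js = ∸-cancelʳ-≤ (<⇒≤ (toℕ<n jt)) (≤-trans rank-js≤rank-j (∸-monoʳ-≤ k jt≤j))

  module _ (wf : WellFormedTRS) (T : Tree) (vT : Valid T) (dpT : label T ≐ DP) where

    leftmost-child : ∀ {t ρt pt n α b U c ρ V} → RulePath T ρt pt →
      (∀ ρ′ qs → Applicable t ρ′ → RulePath T ρ′ qs → pt ⊑ qs) →
      at n pt ≡ just α → at (suc n) pt ≡ just (α ++ b ∷ []) →
      SubtreeAt T α U → label U ρ → SubtreeAt U (c ∷ []) V → label V ρ → Reaches t ρ → b ≤ c
    leftmost-child {n = n} {α} {c = c} (cpt , _) minimal eα eβ sU lU sV lV reach =
      decidable-stable (_ ≤? _) do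
        lT ← label-⊆-subtree (inj₁ vT) sU lU
        qs , rpq ← rulePath-exists T (inj₁ vT) lT
        let |α| = root-chain-length n cpt eα
            |αc| = trans (length-++ α) (trans (ℕ.+-comm _ 1) (cong suc |α|))
            pt⊑qs = minimal _ qs (proj₁ (dpT _) lT , reaches⇒¬NF reach) rpq
            a , ea , a≤c = ⊑-chain-next n cpt (proj₁ rpq) pt⊑qs eα
                             (rulePath-at rpq (_ , sU , lU) |α|)
                             (rulePath-at rpq (_ , SubtreeAt-++⁺ sU sV , lV) |αc|)
        pure (≡.subst (_≤ c) (snoc-injective α (just-injective (trans (sym ea) eβ))) a≤c)

    path-next-≡ : ∀ {s t ps pt n α β v} → StepBelow RR s t → CurPath T s ps → CurPath T t pt →
      at n ps ≡ just α → at n pt ≡ just α → at (suc n) pt ≡ just β →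
      Nrm T ps (suc n) s v → Nrm T pt (suc n) t v → at (suc n) ps ≡ just β
    path-next-≡ _ _ (inj₁ (_ , refl)) _ () _ _ _
    path-next-≡ st (inj₁ (nf , _)) (inj₂ (_ , _ , appT , _)) _ _ _ _ _ =
      contradiction (NF-DP⇒NF nf (proj₁ appT)) (proj₂ (StepBelow-applicable st appT))
    path-next-≡ {ps = ps} {pt} {n} {α} st@(below _ _) (inj₂ (_ , _ , appS , rps@(cps , _) , minS))
                                          (inj₂ (_ , _ , appT , rpt@(cpt , _) , minT)) eαs eαt eβ nrs nrt
      with chain-at-suc n cpt eαt eβ
    ... | b , refl with ⊑-chain-next n cps cpt (minS _ _ (StepBelow-applicable st appT) rpt) eαs eαt eβ
    ... | a , eaS , a≤b
      with rulePath-contains n rps eαs | rulePath-contains (suc n) rps eaS | rulePath-contains (suc n) rpt eβ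
    ... | U , sU , lUs | _ , sVs , lVs | _ , sVt , _ =
      trans eaS (cong (λ x → just (α ++ x ∷ [])) a≡b)
      where
      a≡b : a ≡ b
      a≡b = child-index-≡ U lUs (SubtreeAt-child sU sVs) lVs (SubtreeAt-child sU sVt) a≤b
              (applicable⇒reaches wf appS) (leftmost-child rpt minT eαt eβ sU)
              (nrm-at {ps = ps} {n} nrs eαs sU) (nrm-at {ps = pt} {n} nrt eαt sU)

lemma2 : {F : Set} (ar : F → ℕ) (R : List (Term ar × Term ar)) →
  Framework.WellFormedTRS ar R → Framework.Terminating ar R →
  (T : Framework.Tree ar R) → Framework.ProofTree ar R T →
  (s t : Term ar) → TermOps.StepBelow (Framework.RR ar R) s t →
  (dep : ℕ) → Framework.Depth ar R T dep →
  (i : ℕ) → 1 ≤ i → i < suc dep →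
  (ps pt : List (Framework.Pos ar R)) →
  Framework.CurPath ar R T s ps → Framework.CurPath ar R T t pt →
  Framework.at ar R (i ∸ 1) ps ≡ Framework.at ar R (i ∸ 1) pt →
  Σ (Framework.NVal ar R) (λ v → Framework.Nrm ar R T ps i s v × Framework.Nrm ar R T pt i t v) →
  (Framework.at ar R i pt ≡ nothing) ⊎ (Framework.at ar R i ps ≡ Framework.at ar R i pt)
lemma2 ar R wf _ T (vT , dpT) s t st _ _ (suc n) _ _ ps pt cs ct same-α (_ , nrs , nrt)
  with Framework.at ar R (suc n) pt in eβ
... | nothing = inj₁ refl
... | just _ with at-suc⇒at ar R n pt eβ
...   | _ , eα = inj₂ (path-next-≡ ar R wf T vT dpT {ps = ps} {pt} {n} st cs ct (trans same-α eα) eα eβ nrs nrt)
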